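{- Let $n\ge 4$ and let $\mathcal{P}_n$ be the balanced minimal evolution (BME) polytope on leaf set $[n]$. Let $C_1,\dots,C_k$ ($k\ge 1$) be a collection of clades on pairwise disjoint subsets of $[n]$ that occur simultaneously in at least one binary tree on $[n]$, and let $F$ be the clade-face determined by them, i.e. the convex hull of the points $x(t)$ over all binary trees $t$ on $[n]$ that contain every one of the clades $C_1,\dots,C_k$. Then $F$ is not a facet of $\mathcal{P}_n$.
   Context: A binary tree on leaf set $[n]=\{1,\dots,n\}$ is a tree whose vertices have degree 1 (the leaves, labeled bijectively by $[n]$) or degree 3 (internal nodes). For such a tree $t$ define the vector $x(t)\in\mathbb{R}^{\binom n2}$ with coordinates $x_{ij}(t)=2^{\,n-2-l_{ij}}$ for each pair $\{i,j\}\subset[n]$, where $l_{ij}$ is the number of internal nodes on the path from leaf $i$ to leaf $j$. The BME polytope $\mathcal{P}_n$ is the convex hull of all $x(t)$. A clade of a binary tree is the subtree induced by an internal node $v$ together with everything reachable from $v$ through two chosen edges at $v$ (equivalently, one of the two components obtained by deleting an internal edge, rooted at the end of that edge); it is determined by its leaf set and its rooted binary tree shape. A tree contains a clade if the clade appears in it as such a subtree. It is known that the set of trees containing a given collection of disjoint clades determines a face of $\mathcal{P}_n$ (the clade-face). A facet is a face of codimension one. -}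

module Defs where

open import Data.Nat as ℕ using (ℕ; zero; suc; _∸_; _^_)
open import Data.Fin using (Fin; zero; suc; _<_; _≟_)
open import Data.Maybe using (Maybe; just; nothing)
open import Data.List using (List; []; _∷_; _++_)
open import Data.List.Membership.Propositional using (_∈_)
open import Data.List.Relation.Unary.Unique.Propositional using (Unique)
open import Data.Integer using (+_)
open import Data.Rational using (ℚ; 0ℚ; _/_; _+_; _*_)
open import Data.Product using (Σ; _×_; _,_)
open import Data.Empty using (⊥)
open import Data.Unit using (⊤)
open import Data.Sum using (_⊎_)
open import Relation.Nullary using (¬_; yes; no)
open import Relation.Binary.PropositionalEquality using (_≡_; _≢_)

data RT (n : ℕ) : Set where
  leaf : Fin n → RT n
  node : RT n → RT n → RT n

leaves : ∀ {n} → RT n → List (Fin n)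
leaves (leaf a)   = a ∷ []
leaves (node s t) = leaves s ++ leaves t

_≅_ : ∀ {n} → RT n → RT n → Set
leaf a   ≅ leaf b     = a ≡ b
leaf _   ≅ node _ _   = ⊥
node _ _ ≅ leaf _     = ⊥
node a b ≅ node c d   = ((a ≅ c) × (b ≅ d)) ⊎ ((a ≅ d) × (b ≅ c))

-- An unrooted binary tree is represented by a rooted binary tree obtained
-- by placing a (degree-2, suppressed) root on one of its edges.  Two
-- representatives denote the same unrooted tree iff they are related by
-- rooted isomorphism and moving the root to an adjacent edge.
data _~_ {n : ℕ} : RT n → RT n → Set where
  iso    : ∀ {s t} → s ≅ t → s ~ t
  rot    : ∀ {a b c} → node (node a b) c ~ node a (node b c)
  sym~   : ∀ {s t} → s ~ t → t ~ s
  trans~ : ∀ {s t u} → s ~ t → t ~ u → s ~ u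

IsTree : ∀ {n} → RT n → Set
IsTree {n} t = Unique (leaves t) × (∀ (i : Fin n) → i ∈ leaves t)

IsNode : ∀ {n} → RT n → Set
IsNode (leaf _)   = ⊥
IsNode (node _ _) = ⊤

record Clade (n : ℕ) : Set where
  field
    shape    : RT n
    internal : IsNode shape
    distinct : Unique (leaves shape)
open Clade public

-- A tree contains a clade C if, for some edge e of the tree, the component of
-- (tree minus e) on one side is C, rooted at the endpoint of e on that side
-- (i.e. the tree has a representative rooted on e of the form node C D).
Contains : ∀ {n} → RT n → Clade n → Set
Contains {n} t C = Σ (RT n) λ D → t ~ node (shape C) D

depth : ∀ {n} → RT n → Fin n → Maybe ℕ
depth (leaf a) i with a ≟ i
... | yes _ = just 0
... | no  _ = nothing
depth (node s t) i with depth s i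
... | just d  = just (suc d)
... | nothing with depth t i
...   | just d  = just (suc d)
...   | nothing = nothing

-- number of internal nodes on the i–j path inside a rooted subtree
-- (the root of the subtree counts as an internal node)
rl : ∀ {n} → RT n → Fin n → Fin n → ℕ
rl (leaf _) i j = 0
rl (node s t) i j with depth s i | depth t j | depth s j | depth t i
... | just a  | just b  | _       | _       = a ℕ.+ b ℕ.+ 1
... | _       | _       | just a  | just b  = a ℕ.+ b ℕ.+ 1
... | just _  | _       | just _  | _       = rl s i j
... | _       | just _  | _       | just _  = rl t i j
... | _       | _       | _       | _       = 0

-- l_ij: number of internal nodes on the i–j path in the unrooted tree
-- represented by t (the suppressed degree-2 root is not counted)
lpath : ∀ {n} → RT n → Fin n → Fin n → ℕ
lpath (leaf _) i j = 0
lpath (node s t) i j with depth s i | depth t j | depth s j | depth t i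
... | just a  | just b  | _       | _       = a ℕ.+ b
... | _       | _       | just a  | just b  = a ℕ.+ b
... | just _  | _       | just _  | _       = rl s i j
... | _       | just _  | _       | just _  = rl t i j
... | _       | _       | _       | _       = 0

x : ∀ {n} → RT n → Fin n → Fin n → ℚ
x {n} t i j = (+ (2 ^ (n ∸ 2 ∸ lpath t i j))) / 1

-- Affine dimension of a set of trees' points in ℚ^(n choose 2).
-- (Points have integer coordinates, so affine dependence over ℚ and ℝ agree.)

sumF : ∀ {m} → (Fin m → ℚ) → ℚ
sumF {zero}  f = 0ℚ
sumF {suc m} f = f zero + sumF (λ k → f (suc k))

AffIndep : ∀ {n d} → (Fin (suc d) → Fin n → Fin n → ℚ) → Set
AffIndep {n} {d} p =
  (c : Fin (suc d) → ℚ) →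
  sumF c ≡ 0ℚ →
  (∀ (i j : Fin n) → i < j → sumF (λ k → c k * p k i j) ≡ 0ℚ) →
  ∀ k → c k ≡ 0ℚ

HasIndep : ∀ {n} → (RT n → Set) → ℕ → Set
HasIndep {n} S d =
  Σ (Fin (suc d) → RT n) λ ts → (∀ k → S (ts k)) × AffIndep (λ k → x (ts k))

AffDim : ∀ {n} → (RT n → Set) → ℕ → Set
AffDim S d = HasIndep S d × ¬ HasIndep S (suc d)

CladeFace : ∀ {n k} → (Fin k → Clade n) → RT n → Set
CladeFace C t = IsTree t × (∀ a → Contains t (C a))

PairwiseDisjoint : ∀ {n k} → (Fin k → Clade n) → Set
PairwiseDisjoint {n} C =
  ∀ a b → a ≢ b → ∀ (i : Fin n) → i ∈ leaves (shape (C a)) → i ∈ leaves (shape (C b)) → ⊥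

-- F is a facet of P_n: dim F = dim P_n - 1  (F is known to be a face)
IsFacetOfBME : ∀ {n} → (RT n → Set) → Set
IsFacetOfBME {n} F = Σ ℕ λ d → AffDim F d × AffDim (IsTree {n}) (suc d)

-- Let {i, j} be a cherry of the first clade. In every tree containing the clade, i and j hang
-- from the same internal node, so x_ij = 2^(n-3) and x_ai = x_aj for every other leaf a: the
-- face lies in an affine subspace of codimension two. The quartet trees with cherries {a, i}
-- and {a, j} break these two equations independently, so adjoining them to affinely
-- independent points of the face keeps them independent, and dim P_n ≥ dim F + 2.

module Submission where

open import Defs
open import Data.Nat using (ℕ; suc; _≤_)
open import Data.Fin using (Fin)
open import Data.Product using (Σ; _×_)
open import Relation.Nullary using (¬_)

open import Function using (_∘_)
open import Data.Empty using (⊥-elim)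
open import Data.Unit using (tt)
open import Data.Product using (_,_; proj₁; proj₂; ∃)
open import Data.Sum using (inj₁; inj₂)
open import Data.Maybe using (Maybe; just; nothing)
open import Relation.Nullary using (yes; no)
open import Relation.Binary.Definitions using (tri<; tri≈; tri>)
open import Relation.Binary.PropositionalEquality

open import Data.Nat as ℕ using (zero; _+_; _∸_; _^_; z≤n; s≤s)
open import Data.Nat.Properties as ℕ using (+-comm; +-suc; ^-monoʳ-<)
import Data.Nat.Coprimality as Coprimality
open import Data.Fin using (zero; suc; _≟_; _<_)
open import Data.Fin.Properties using (<-cmp; pigeonhole; ¬∀⟶∃¬) renaming (<⇒≢ to <⇒≢ᶠ)
open import Data.Integer using (+_)
import Data.Integer.Properties as ℤ
open import Data.Rational using (ℚ; 0ℚ; 1ℚ; _/_; _*_; _-_; ↥_; 1/_; ≢-nonZero)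
  renaming (_+_ to _+ℚ_)
open import Data.Rational.Properties
  using (*-zeroˡ; *-identityʳ; *-inverseʳ; *-assoc; *-distribʳ-+; +-identityˡ; +-0-group; normalize-coprime)
open import Data.Rational.Solver using (module +-*-Solver)
import Algebra.Properties.Group as GroupProperties

open import Data.List using (List; []; _∷_; _++_; length; lookup; filter; allFin)
open import Data.List.Properties using (++-assoc)
open import Data.List.Relation.Unary.Any using (here; there; index)
open import Data.List.Relation.Unary.Any.Properties using (lookup-index)
import Data.List.Relation.Unary.All as All
import Data.List.Relation.Unary.All.Properties as All
open import Data.List.Relation.Unary.AllPairs using ([]; _∷_)
open import Data.List.Relation.Unary.Unique.Propositional using (Unique)
open import Data.List.Relation.Unary.Unique.Propositional.Properties using (filter⁺; allFin⁺)
  renaming (++⁺ to Unique-++⁺)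
open import Data.List.Membership.Propositional using (_∈_; _∉_)
open import Data.List.Membership.Propositional.Properties
  using (∈-++⁺ˡ; ∈-++⁺ʳ; ∈-++⁻; ∈-filter⁺; ∈-filter⁻; ∈-allFin)
import Data.List.Membership.DecPropositional as DecMembership
open import Data.List.Relation.Binary.Permutation.Propositional
  using (_↭_; ↭-refl; ↭-sym; ↭-trans; ↭-reflexive; ↭-prep; ↭-swap; ↭⇒↭ₛ)
open import Data.List.Relation.Binary.Permutation.Propositional.Properties using (++⁺; ++-comm)
open import Data.List.Relation.Binary.Permutation.Setoid.Properties using (Unique-resp-↭)
open import Data.Vec.Functional using () renaming (_∷_ to _◂_)

nodeDepth : Maybe ℕ → Maybe ℕ → Maybe ℕ
nodeDepth (just d) _        = just (suc d)
nodeDepth nothing  (just d) = just (suc d)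
nodeDepth nothing  nothing  = nothing

nodeRl : Maybe ℕ → Maybe ℕ → Maybe ℕ → Maybe ℕ → ℕ → ℕ → ℕ
nodeRl (just a) (just b) _        _        _  _  = a + b + 1
nodeRl _        _        (just a) (just b) _  _  = a + b + 1
nodeRl (just _) _        (just _) _        r₁ _  = r₁
nodeRl _        (just _) _        (just _) _  r₂ = r₂
nodeRl _        _        _        _        _  _  = 0

nodeLpath : Maybe ℕ → Maybe ℕ → Maybe ℕ → Maybe ℕ → ℕ → ℕ → ℕ
nodeLpath (just a) (just b) _        _        _  _  = a + b
nodeLpath _        _        (just a) (just b) _  _  = a + b
nodeLpath (just _) _        (just _) _        r₁ _  = r₁
nodeLpath _        (just _) _        (just _) _  r₂ = r₂
nodeLpath _        _        _        _        _  _  = 0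

module _ {n : ℕ} (s t : RT n) where

  depth-node : ∀ i → depth (node s t) i ≡ nodeDepth (depth s i) (depth t i)
  depth-node i with depth s i
  ... | just _  = refl
  ... | nothing with depth t i
  ...   | just _  = refl
  ...   | nothing = refl

  rl-node : ∀ i j →
    rl (node s t) i j ≡ nodeRl (depth s i) (depth t j) (depth s j) (depth t i) (rl s i j) (rl t i j)
  rl-node i j with depth s i | depth t j | depth s j | depth t i
  ... | just _  | just _  | _       | _       = refl
  ... | just _  | nothing | just _  | just _  = refl
  ... | just _  | nothing | just _  | nothing = refl
  ... | just _  | nothing | nothing | _       = refl
  ... | nothing | _       | just _  | just _  = refl
  ... | nothing | just _  | just _  | nothing = refl
  ... | nothing | just _  | nothing | just _  = refl
  ... | nothing | just _  | nothing | nothing = refl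
  ... | nothing | nothing | just _  | nothing = refl
  ... | nothing | nothing | nothing | _       = refl

  lpath-node : ∀ i j →
    lpath (node s t) i j ≡ nodeLpath (depth s i) (depth t j) (depth s j) (depth t i) (rl s i j) (rl t i j)
  lpath-node i j with depth s i | depth t j | depth s j | depth t i
  ... | just _  | just _  | _       | _       = refl
  ... | just _  | nothing | just _  | just _  = refl
  ... | just _  | nothing | just _  | nothing = refl
  ... | just _  | nothing | nothing | _       = refl
  ... | nothing | _       | just _  | just _  = refl
  ... | nothing | just _  | just _  | nothing = refl
  ... | nothing | just _  | nothing | just _  = refl
  ... | nothing | just _  | nothing | nothing = refl
  ... | nothing | nothing | just _  | nothing = refl
  ... | nothing | nothing | nothing | _       = refl

private
  cong₆ : ∀ {A B C D E F R : Set} (f : A → B → C → D → E → F → R)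
    {a a′ b b′ c c′ d d′ e e′ g g′} → a ≡ a′ → b ≡ b′ → c ≡ c′ → d ≡ d′ → e ≡ e′ → g ≡ g′ →
    f a b c d e g ≡ f a′ b′ c′ d′ e′ g′
  cong₆ f refl refl refl refl refl refl = refl

-- the possible values of (depth s i, depth t i) when s and t have no common leaf
data AtMostOne : Maybe ℕ → Maybe ℕ → Set where
  inˡ  : ∀ {a} → AtMostOne (just a) nothing
  inʳ  : ∀ {b} → AtMostOne nothing (just b)
  none : AtMostOne nothing nothing

data AtMostOne₃ : Maybe ℕ → Maybe ℕ → Maybe ℕ → Set where
  in₁  : ∀ {a} → AtMostOne₃ (just a) nothing nothing
  in₂  : ∀ {b} → AtMostOne₃ nothing (just b) nothing
  in₃  : ∀ {c} → AtMostOne₃ nothing nothing (just c)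
  none : AtMostOne₃ nothing nothing nothing

atMostOne₃ : ∀ {a b c} → AtMostOne a b → AtMostOne a c → AtMostOne b c → AtMostOne₃ a b c
atMostOne₃ inˡ  inˡ  none = in₁
atMostOne₃ inʳ  none inˡ  = in₂
atMostOne₃ none inʳ  inʳ  = in₃
atMostOne₃ none none none = none

nodeDepth≡nothing : ∀ {a b} → nodeDepth a b ≡ nothing → a ≡ nothing × b ≡ nothing
nodeDepth≡nothing {nothing} {nothing} _ = refl , refl

nodeRl-absentˡ : ∀ b c r₁ r₂ → nodeRl nothing b c nothing r₁ r₂ ≡ 0
nodeRl-absentˡ (just _) (just _) _ _ = refl
nodeRl-absentˡ (just _) nothing  _ _ = refl
nodeRl-absentˡ nothing  (just _) _ _ = refl
nodeRl-absentˡ nothing  nothing  _ _ = refl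

nodeRl-absentʳ : ∀ a d r₁ r₂ → nodeRl a nothing nothing d r₁ r₂ ≡ 0
nodeRl-absentʳ (just _) (just _) _ _ = refl
nodeRl-absentʳ (just _) nothing  _ _ = refl
nodeRl-absentʳ nothing  (just _) _ _ = refl
nodeRl-absentʳ nothing  nothing  _ _ = refl

private
  +1-comm : ∀ a b → a + b + 1 ≡ b + a + 1
  +1-comm a b = cong (_+ 1) (+-comm a b)

  suc+≡+1 : ∀ a b → suc a + b ≡ a + b + 1
  suc+≡+1 a b = +-comm 1 (a + b)

  +suc≡+1 : ∀ a b → a + suc b ≡ a + b + 1
  +suc≡+1 a b = trans (+-suc a b) (+-comm 1 (a + b))

nodeDepth-comm : ∀ {a b} → AtMostOne a b → nodeDepth a b ≡ nodeDepth b a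
nodeDepth-comm inˡ  = refl
nodeDepth-comm inʳ  = refl
nodeDepth-comm none = refl

nodeRl-comm : ∀ {aᵢ bᵢ aⱼ bⱼ} r₁ r₂ → AtMostOne aᵢ bᵢ → AtMostOne aⱼ bⱼ →
  nodeRl aᵢ bⱼ aⱼ bᵢ r₁ r₂ ≡ nodeRl bᵢ aⱼ bⱼ aᵢ r₂ r₁
nodeRl-comm r₁ r₂ (inˡ {a}) (inʳ {b}) = +1-comm a b
nodeRl-comm r₁ r₂ (inʳ {b}) (inˡ {a}) = +1-comm a b
nodeRl-comm r₁ r₂ inˡ  inˡ  = refl
nodeRl-comm r₁ r₂ inˡ  none = refl
nodeRl-comm r₁ r₂ inʳ  inʳ  = refl
nodeRl-comm r₁ r₂ inʳ  none = refl
nodeRl-comm r₁ r₂ none inˡ  = refl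
nodeRl-comm r₁ r₂ none inʳ  = refl
nodeRl-comm r₁ r₂ none none = refl

nodeLpath-comm : ∀ {aᵢ bᵢ aⱼ bⱼ} r₁ r₂ → AtMostOne aᵢ bᵢ → AtMostOne aⱼ bⱼ →
  nodeLpath aᵢ bⱼ aⱼ bᵢ r₁ r₂ ≡ nodeLpath bᵢ aⱼ bⱼ aᵢ r₂ r₁
nodeLpath-comm r₁ r₂ (inˡ {a}) (inʳ {b}) = +-comm a b
nodeLpath-comm r₁ r₂ (inʳ {b}) (inˡ {a}) = +-comm a b
nodeLpath-comm r₁ r₂ inˡ  inˡ  = refl
nodeLpath-comm r₁ r₂ inˡ  none = refl
nodeLpath-comm r₁ r₂ inʳ  inʳ  = refl
nodeLpath-comm r₁ r₂ inʳ  none = refl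
nodeLpath-comm r₁ r₂ none inˡ  = refl
nodeLpath-comm r₁ r₂ none inʳ  = refl
nodeLpath-comm r₁ r₂ none none = refl

nodeRl-sym : ∀ {aᵢ bᵢ aⱼ bⱼ} r₁ r₂ → AtMostOne aᵢ bᵢ → AtMostOne aⱼ bⱼ →
  nodeRl aᵢ bⱼ aⱼ bᵢ r₁ r₂ ≡ nodeRl aⱼ bᵢ aᵢ bⱼ r₁ r₂
nodeRl-sym r₁ r₂ inˡ  inˡ  = refl
nodeRl-sym r₁ r₂ inˡ  inʳ  = refl
nodeRl-sym r₁ r₂ inˡ  none = refl
nodeRl-sym r₁ r₂ inʳ  inˡ  = refl
nodeRl-sym r₁ r₂ inʳ  inʳ  = refl
nodeRl-sym r₁ r₂ inʳ  none = refl
nodeRl-sym r₁ r₂ none inˡ  = refl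
nodeRl-sym r₁ r₂ none inʳ  = refl
nodeRl-sym r₁ r₂ none none = refl

nodeLpath-sym : ∀ {aᵢ bᵢ aⱼ bⱼ} r₁ r₂ → AtMostOne aᵢ bᵢ → AtMostOne aⱼ bⱼ →
  nodeLpath aᵢ bⱼ aⱼ bᵢ r₁ r₂ ≡ nodeLpath aⱼ bᵢ aᵢ bⱼ r₁ r₂
nodeLpath-sym r₁ r₂ inˡ  inˡ  = refl
nodeLpath-sym r₁ r₂ inˡ  inʳ  = refl
nodeLpath-sym r₁ r₂ inˡ  none = refl
nodeLpath-sym r₁ r₂ inʳ  inˡ  = refl
nodeLpath-sym r₁ r₂ inʳ  inʳ  = refl
nodeLpath-sym r₁ r₂ inʳ  none = refl
nodeLpath-sym r₁ r₂ none inˡ  = refl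
nodeLpath-sym r₁ r₂ none inʳ  = refl
nodeLpath-sym r₁ r₂ none none = refl

nodeLpath-assoc : ∀ {aᵢ bᵢ cᵢ aⱼ bⱼ cⱼ} r₁ r₂ r₃ → AtMostOne₃ aᵢ bᵢ cᵢ → AtMostOne₃ aⱼ bⱼ cⱼ →
  nodeLpath (nodeDepth aᵢ bᵢ) cⱼ (nodeDepth aⱼ bⱼ) cᵢ (nodeRl aᵢ bⱼ aⱼ bᵢ r₁ r₂) r₃ ≡
  nodeLpath aᵢ (nodeDepth bⱼ cⱼ) aⱼ (nodeDepth bᵢ cᵢ) r₁ (nodeRl bᵢ cⱼ bⱼ cᵢ r₂ r₃)
nodeLpath-assoc _ _ _ in₁ in₁ = refl
nodeLpath-assoc _ _ _ (in₁ {a}) (in₂ {b}) = sym (+suc≡+1 a b)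
nodeLpath-assoc _ _ _ (in₁ {a}) (in₃ {c}) = sym (+-suc a c)
nodeLpath-assoc _ _ _ in₁ none = refl
nodeLpath-assoc _ _ _ (in₂ {b}) (in₁ {a}) = sym (+suc≡+1 a b)
nodeLpath-assoc _ _ _ in₂ in₂ = refl
nodeLpath-assoc _ _ _ (in₂ {b}) (in₃ {c}) = suc+≡+1 b c
nodeLpath-assoc _ _ _ in₂ none = refl
nodeLpath-assoc _ _ _ (in₃ {c}) (in₁ {a}) = sym (+-suc a c)
nodeLpath-assoc _ _ _ (in₃ {c}) (in₂ {b}) = suc+≡+1 b c
nodeLpath-assoc _ _ _ in₃ in₃ = refl
nodeLpath-assoc _ _ _ in₃ none = refl
nodeLpath-assoc _ _ _ none in₁ = refl
nodeLpath-assoc _ _ _ none in₂ = refl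
nodeLpath-assoc _ _ _ none in₃ = refl
nodeLpath-assoc _ _ _ none none = refl

module _ {A : Set} where

  Unique-++⁻ˡ : ∀ xs {ys : List A} → Unique (xs ++ ys) → Unique xs
  Unique-++⁻ˡ []       _        = []
  Unique-++⁻ˡ (x ∷ xs) (x∉ ∷ u) = All.++⁻ˡ xs x∉ ∷ Unique-++⁻ˡ xs u

  Unique-++⁻ʳ : ∀ xs {ys : List A} → Unique (xs ++ ys) → Unique ys
  Unique-++⁻ʳ []       u       = u
  Unique-++⁻ʳ (x ∷ xs) (_ ∷ u) = Unique-++⁻ʳ xs u

  Unique-++⇒disjoint : ∀ xs {ys : List A} {z} → Unique (xs ++ ys) → z ∈ xs → z ∉ ys
  Unique-++⇒disjoint (x ∷ xs) (x∉ ∷ _) (here refl) z∈ys = All.lookup x∉ (∈-++⁺ʳ xs z∈ys) refl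
  Unique-++⇒disjoint (x ∷ xs) (_ ∷ u)  (there z∈xs) = Unique-++⇒disjoint xs u z∈xs

  Unique-swap : ∀ {a b c : A} {xs} → Unique (a ∷ b ∷ c ∷ xs) → Unique (a ∷ c ∷ b ∷ xs)
  Unique-swap {a} {b} {c} = Unique-resp-↭ (setoid A) (↭⇒↭ₛ (↭-prep a (↭-swap b c ↭-refl)))

module _ {n : ℕ} where

  depth-leaf-self : (a : Fin n) → depth (leaf a) a ≡ just 0
  depth-leaf-self a with a ≟ a
  ... | yes _   = refl
  ... | no  a≢a = ⊥-elim (a≢a refl)

  depth-leaf-other : {a i : Fin n} → a ≢ i → depth (leaf a) i ≡ nothing
  depth-leaf-other {a} {i} a≢i with a ≟ i
  ... | yes a≡i = ⊥-elim (a≢i a≡i)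
  ... | no  _   = refl

  depth≡just⇒∈ : ∀ (s : RT n) {i d} → depth s i ≡ just d → i ∈ leaves s
  depth≡just⇒∈ (leaf a) {i} eq with a ≟ i
  ... | yes a≡i = here (sym a≡i)
  depth≡just⇒∈ (node s t) {i} eq with depth s i in eˢ
  ... | just _  = ∈-++⁺ˡ (depth≡just⇒∈ s eˢ)
  ... | nothing with depth t i in eᵗ
  ...   | just _ = ∈-++⁺ʳ (leaves s) (depth≡just⇒∈ t eᵗ)

  depth≡nothing⇒∉ : ∀ (s : RT n) {i} → depth s i ≡ nothing → i ∉ leaves s
  depth≡nothing⇒∉ (leaf a) {i} eq (here i≡a) with a ≟ i
  ... | no a≢i = a≢i (sym i≡a)
  depth≡nothing⇒∉ (node s t) {i} eq i∈ with depth s i in eˢ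
  ... | nothing with depth t i in eᵗ
  ...   | nothing with ∈-++⁻ (leaves s) i∈
  ...     | inj₁ i∈s = depth≡nothing⇒∉ s eˢ i∈s
  ...     | inj₂ i∈t = depth≡nothing⇒∉ t eᵗ i∈t

  ∈⇒depth≡just : ∀ (s : RT n) {i} → i ∈ leaves s → ∃ λ d → depth s i ≡ just d
  ∈⇒depth≡just s {i} i∈s with depth s i in e
  ... | just d  = d , refl
  ... | nothing = ⊥-elim (depth≡nothing⇒∉ s e i∈s)

  ∉⇒depth≡nothing : ∀ (s : RT n) {i} → i ∉ leaves s → depth s i ≡ nothing
  ∉⇒depth≡nothing s {i} i∉s with depth s i in e
  ... | just _  = ⊥-elim (i∉s (depth≡just⇒∈ s e))
  ... | nothing = refl

  atMostOne : ∀ (s t : RT n) → (∀ {i} → i ∈ leaves s → i ∉ leaves t) →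
              ∀ i → AtMostOne (depth s i) (depth t i)
  atMostOne s t disjoint i with depth s i in eˢ | depth t i in eᵗ
  ... | just _  | just _  = ⊥-elim (disjoint (depth≡just⇒∈ s eˢ) (depth≡just⇒∈ t eᵗ))
  ... | just _  | nothing = inˡ
  ... | nothing | just _  = inʳ
  ... | nothing | nothing = none

  rl-absentˡ : ∀ (s : RT n) {i} k → depth s i ≡ nothing → rl s i k ≡ 0
  rl-absentˡ (leaf _)   k _ = refl
  rl-absentˡ (node s t) {i} k e with nodeDepth≡nothing (trans (sym (depth-node s t i)) e)
  ... | eˢ , eᵗ rewrite rl-node s t i k | eˢ | eᵗ = nodeRl-absentˡ (depth t k) (depth s k) (rl s i k) (rl t i k)

  rl-absentʳ : ∀ (s : RT n) i {k} → depth s k ≡ nothing → rl s i k ≡ 0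
  rl-absentʳ (leaf _)   i _ = refl
  rl-absentʳ (node s t) i {k} e with nodeDepth≡nothing (trans (sym (depth-node s t k)) e)
  ... | eˢ , eᵗ rewrite rl-node s t i k | eˢ | eᵗ = nodeRl-absentʳ (depth s i) (depth t i) (rl s i k) (rl t i k)

  module _ (s t : RT n) (u : Unique (leaves (node s t))) where

    Unique-nodeˡ : Unique (leaves s)
    Unique-nodeˡ = Unique-++⁻ˡ (leaves s) u

    Unique-nodeʳ : Unique (leaves t)
    Unique-nodeʳ = Unique-++⁻ʳ (leaves s) u

    atMostOne-node : ∀ i → AtMostOne (depth s i) (depth t i)
    atMostOne-node = atMostOne s t (Unique-++⇒disjoint (leaves s) u)

    ∈ˡ⇒depthʳ≡nothing : ∀ {i} → i ∈ leaves s → depth t i ≡ nothing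
    ∈ˡ⇒depthʳ≡nothing i∈s = ∉⇒depth≡nothing t (Unique-++⇒disjoint (leaves s) u i∈s)

    ∈ʳ⇒depthˡ≡nothing : ∀ {i} → i ∈ leaves t → depth s i ≡ nothing
    ∈ʳ⇒depthˡ≡nothing i∈t = ∉⇒depth≡nothing s (λ i∈s → Unique-++⇒disjoint (leaves s) u i∈s i∈t)

    module _ {i j : Fin n} where

      ∈ˡ⇒depthʳ-≡ : i ∈ leaves s → j ∈ leaves s → depth t i ≡ depth t j
      ∈ˡ⇒depthʳ-≡ i∈s j∈s = trans (∈ˡ⇒depthʳ≡nothing i∈s) (sym (∈ˡ⇒depthʳ≡nothing j∈s))

      ∈ʳ⇒depthˡ-≡ : i ∈ leaves t → j ∈ leaves t → depth s i ≡ depth s j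
      ∈ʳ⇒depthˡ-≡ i∈t j∈t = trans (∈ʳ⇒depthˡ≡nothing i∈t) (sym (∈ʳ⇒depthˡ≡nothing j∈t))

      ∈ˡ⇒rlʳ-≡ : i ∈ leaves s → j ∈ leaves s → ∀ k → rl t i k ≡ rl t j k
      ∈ˡ⇒rlʳ-≡ i∈s j∈s k = trans (rl-absentˡ t k (∈ˡ⇒depthʳ≡nothing i∈s)) (sym (rl-absentˡ t k (∈ˡ⇒depthʳ≡nothing j∈s)))

      ∈ʳ⇒rlˡ-≡ : i ∈ leaves t → j ∈ leaves t → ∀ k → rl s i k ≡ rl s j k
      ∈ʳ⇒rlˡ-≡ i∈t j∈t k = trans (rl-absentˡ s k (∈ʳ⇒depthˡ≡nothing i∈t)) (sym (rl-absentˡ s k (∈ʳ⇒depthˡ≡nothing j∈t)))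

-- Path lengths are invariants of the unrooted tree

module _ {n : ℕ} where

  ≅⇒↭ : {s t : RT n} → s ≅ t → leaves s ↭ leaves t
  ≅⇒↭ {leaf _}   {leaf _}   refl           = ↭-refl
  ≅⇒↭ {node _ _} {node _ _} (inj₁ (p , q)) = ++⁺ (≅⇒↭ p) (≅⇒↭ q)
  ≅⇒↭ {node _ _} {node c d} (inj₂ (p , q)) = ↭-trans (++⁺ (≅⇒↭ p) (≅⇒↭ q)) (++-comm (leaves d) (leaves c))

  ~⇒↭ : {s t : RT n} → s ~ t → leaves s ↭ leaves t
  ~⇒↭ (iso p)             = ≅⇒↭ p
  ~⇒↭ (rot {a} {b} {c})   = ↭-reflexive (++-assoc (leaves a) (leaves b) (leaves c))
  ~⇒↭ (sym~ p)            = ↭-sym (~⇒↭ p)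
  ~⇒↭ (trans~ p q)        = ↭-trans (~⇒↭ p) (~⇒↭ q)

  Unique-resp-~ : {s t : RT n} → s ~ t → Unique (leaves s) → Unique (leaves t)
  Unique-resp-~ p = Unique-resp-↭ (setoid (Fin n)) (↭⇒↭ₛ (~⇒↭ p))

  ≅-depth : {s t : RT n} → s ≅ t → Unique (leaves s) → ∀ i → depth s i ≡ depth t i
  ≅-depth {leaf _}   {leaf _}   refl           _ i = refl
  ≅-depth {node a b} {node c d} (inj₁ (p , q)) u i = begin
    depth (node a b) i                ≡⟨ depth-node a b i ⟩
    nodeDepth (depth a i) (depth b i) ≡⟨ cong₂ nodeDepth (≅-depth p (Unique-nodeˡ a b u) i) (≅-depth q (Unique-nodeʳ a b u) i) ⟩
    nodeDepth (depth c i) (depth d i) ≡⟨ depth-node c d i ⟨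
    depth (node c d) i                ∎
    where open ≡-Reasoning
  ≅-depth {node a b} {node c d} (inj₂ (p , q)) u i = begin
    depth (node a b) i                ≡⟨ depth-node a b i ⟩
    nodeDepth (depth a i) (depth b i) ≡⟨ nodeDepth-comm (atMostOne-node a b u i) ⟩
    nodeDepth (depth b i) (depth a i) ≡⟨ cong₂ nodeDepth (≅-depth q (Unique-nodeʳ a b u) i) (≅-depth p (Unique-nodeˡ a b u) i) ⟩
    nodeDepth (depth c i) (depth d i) ≡⟨ depth-node c d i ⟨
    depth (node c d) i                ∎
    where open ≡-Reasoning

  ≅-rl : {s t : RT n} → s ≅ t → Unique (leaves s) → ∀ i j → rl s i j ≡ rl t i j
  ≅-rl {leaf _}   {leaf _}   refl           _ i j = refl
  ≅-rl {node a b} {node c d} (inj₁ (p , q)) u i j = begin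
    rl (node a b) i j ≡⟨ rl-node a b i j ⟩
    nodeRl (depth a i) (depth b j) (depth a j) (depth b i) (rl a i j) (rl b i j)
      ≡⟨ cong₆ nodeRl (≅-depth p uˡ i) (≅-depth q uʳ j) (≅-depth p uˡ j) (≅-depth q uʳ i) (≅-rl p uˡ i j) (≅-rl q uʳ i j) ⟩
    nodeRl (depth c i) (depth d j) (depth c j) (depth d i) (rl c i j) (rl d i j) ≡⟨ rl-node c d i j ⟨
    rl (node c d) i j ∎
    where open ≡-Reasoning
          uˡ = Unique-nodeˡ a b u
          uʳ = Unique-nodeʳ a b u
  ≅-rl {node a b} {node c d} (inj₂ (p , q)) u i j = begin
    rl (node a b) i j ≡⟨ rl-node a b i j ⟩
    nodeRl (depth a i) (depth b j) (depth a j) (depth b i) (rl a i j) (rl b i j)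
      ≡⟨ nodeRl-comm (rl a i j) (rl b i j) (atMostOne-node a b u i) (atMostOne-node a b u j) ⟩
    nodeRl (depth b i) (depth a j) (depth b j) (depth a i) (rl b i j) (rl a i j)
      ≡⟨ cong₆ nodeRl (≅-depth q uʳ i) (≅-depth p uˡ j) (≅-depth q uʳ j) (≅-depth p uˡ i) (≅-rl q uʳ i j) (≅-rl p uˡ i j) ⟩
    nodeRl (depth c i) (depth d j) (depth c j) (depth d i) (rl c i j) (rl d i j) ≡⟨ rl-node c d i j ⟨
    rl (node c d) i j ∎
    where open ≡-Reasoning
          uˡ = Unique-nodeˡ a b u
          uʳ = Unique-nodeʳ a b u

  ≅-lpath : {s t : RT n} → s ≅ t → Unique (leaves s) → ∀ i j → lpath s i j ≡ lpath t i j
  ≅-lpath {leaf _}   {leaf _}   refl           _ i j = refl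
  ≅-lpath {node a b} {node c d} (inj₁ (p , q)) u i j = begin
    lpath (node a b) i j ≡⟨ lpath-node a b i j ⟩
    nodeLpath (depth a i) (depth b j) (depth a j) (depth b i) (rl a i j) (rl b i j)
      ≡⟨ cong₆ nodeLpath (≅-depth p uˡ i) (≅-depth q uʳ j) (≅-depth p uˡ j) (≅-depth q uʳ i) (≅-rl p uˡ i j) (≅-rl q uʳ i j) ⟩
    nodeLpath (depth c i) (depth d j) (depth c j) (depth d i) (rl c i j) (rl d i j) ≡⟨ lpath-node c d i j ⟨
    lpath (node c d) i j ∎
    where open ≡-Reasoning
          uˡ = Unique-nodeˡ a b u
          uʳ = Unique-nodeʳ a b u
  ≅-lpath {node a b} {node c d} (inj₂ (p , q)) u i j = begin
    lpath (node a b) i j ≡⟨ lpath-node a b i j ⟩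
    nodeLpath (depth a i) (depth b j) (depth a j) (depth b i) (rl a i j) (rl b i j)
      ≡⟨ nodeLpath-comm (rl a i j) (rl b i j) (atMostOne-node a b u i) (atMostOne-node a b u j) ⟩
    nodeLpath (depth b i) (depth a j) (depth b j) (depth a i) (rl b i j) (rl a i j)
      ≡⟨ cong₆ nodeLpath (≅-depth q uʳ i) (≅-depth p uˡ j) (≅-depth q uʳ j) (≅-depth p uˡ i) (≅-rl q uʳ i j) (≅-rl p uˡ i j) ⟩
    nodeLpath (depth c i) (depth d j) (depth c j) (depth d i) (rl c i j) (rl d i j) ≡⟨ lpath-node c d i j ⟨
    lpath (node c d) i j ∎
    where open ≡-Reasoning
          uˡ = Unique-nodeˡ a b u
          uʳ = Unique-nodeʳ a b u

  rot-lpath : (a b c : RT n) → Unique (leaves (node (node a b) c)) → ∀ i j →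
              lpath (node (node a b) c) i j ≡ lpath (node a (node b c)) i j
  rot-lpath a b c u i j = begin
    lpath (node (node a b) c) i j
      ≡⟨ lpath-node (node a b) c i j ⟩
    nodeLpath (depth (node a b) i) (depth c j) (depth (node a b) j) (depth c i) (rl (node a b) i j) (rl c i j)
      ≡⟨ cong₆ nodeLpath (depth-node a b i) (refl {x = depth c j}) (depth-node a b j) (refl {x = depth c i})
                         (rl-node a b i j) (refl {x = rl c i j}) ⟩
    nodeLpath (nodeDepth (depth a i) (depth b i)) (depth c j) (nodeDepth (depth a j) (depth b j)) (depth c i)
              (nodeRl (depth a i) (depth b j) (depth a j) (depth b i) (rl a i j) (rl b i j)) (rl c i j)
      ≡⟨ nodeLpath-assoc (rl a i j) (rl b i j) (rl c i j) (atMostOne-abc i) (atMostOne-abc j) ⟩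
    nodeLpath (depth a i) (nodeDepth (depth b j) (depth c j)) (depth a j) (nodeDepth (depth b i) (depth c i))
              (rl a i j) (nodeRl (depth b i) (depth c j) (depth b j) (depth c i) (rl b i j) (rl c i j))
      ≡⟨ cong₆ nodeLpath (refl {x = depth a i}) (depth-node b c j) (refl {x = depth a j}) (depth-node b c i)
                         (refl {x = rl a i j}) (rl-node b c i j) ⟨
    nodeLpath (depth a i) (depth (node b c) j) (depth a j) (depth (node b c) i) (rl a i j) (rl (node b c) i j)
      ≡⟨ lpath-node a (node b c) i j ⟨
    lpath (node a (node b c)) i j ∎
    where
    open ≡-Reasoning
    ab = leaves a ++ leaves b
    atMostOne-abc : ∀ i → AtMostOne₃ (depth a i) (depth b i) (depth c i)
    atMostOne-abc i = atMostOne₃ (atMostOne-node a b (Unique-nodeˡ (node a b) c u) i)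
      (atMostOne a c (λ z∈a → Unique-++⇒disjoint ab u (∈-++⁺ˡ z∈a)) i)
      (atMostOne b c (λ z∈b → Unique-++⇒disjoint ab u (∈-++⁺ʳ (leaves a) z∈b)) i)

  ~-lpath : {s t : RT n} → s ~ t → Unique (leaves s) → ∀ i j → lpath s i j ≡ lpath t i j
  ~-lpath (iso p)             u     = ≅-lpath p u
  ~-lpath (rot {a} {b} {c})   u     = rot-lpath a b c u
  ~-lpath (sym~ p)            u i j = sym (~-lpath p (Unique-resp-~ (sym~ p) u) i j)
  ~-lpath (trans~ p q)        u i j = trans (~-lpath p u i j) (~-lpath q (Unique-resp-~ p u) i j)

  rl-sym : (s : RT n) → Unique (leaves s) → ∀ i j → rl s i j ≡ rl s j i
  rl-sym (leaf _)   _ i j = refl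
  rl-sym (node s t) u i j = begin
    rl (node s t) i j ≡⟨ rl-node s t i j ⟩
    nodeRl (depth s i) (depth t j) (depth s j) (depth t i) (rl s i j) (rl t i j)
      ≡⟨ nodeRl-sym (rl s i j) (rl t i j) (atMostOne-node s t u i) (atMostOne-node s t u j) ⟩
    nodeRl (depth s j) (depth t i) (depth s i) (depth t j) (rl s i j) (rl t i j)
      ≡⟨ cong₂ (nodeRl (depth s j) (depth t i) (depth s i) (depth t j))
               (rl-sym s (Unique-nodeˡ s t u) i j) (rl-sym t (Unique-nodeʳ s t u) i j) ⟩
    nodeRl (depth s j) (depth t i) (depth s i) (depth t j) (rl s j i) (rl t j i) ≡⟨ rl-node s t j i ⟨
    rl (node s t) j i ∎
    where open ≡-Reasoning

  lpath-sym : (s : RT n) → Unique (leaves s) → ∀ i j → lpath s i j ≡ lpath s j i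
  lpath-sym (leaf _)   _ i j = refl
  lpath-sym (node s t) u i j = begin
    lpath (node s t) i j ≡⟨ lpath-node s t i j ⟩
    nodeLpath (depth s i) (depth t j) (depth s j) (depth t i) (rl s i j) (rl t i j)
      ≡⟨ nodeLpath-sym (rl s i j) (rl t i j) (atMostOne-node s t u i) (atMostOne-node s t u j) ⟩
    nodeLpath (depth s j) (depth t i) (depth s i) (depth t j) (rl s i j) (rl t i j)
      ≡⟨ cong₂ (nodeLpath (depth s j) (depth t i) (depth s i) (depth t j))
               (rl-sym s (Unique-nodeˡ s t u) i j) (rl-sym t (Unique-nodeʳ s t u) i j) ⟩
    nodeLpath (depth s j) (depth t i) (depth s i) (depth t j) (rl s j i) (rl t j i) ≡⟨ lpath-node s t j i ⟨
    lpath (node s t) j i ∎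
    where open ≡-Reasoning

-- Cherries

module _ {n : ℕ} where

  module _ (s t : RT n) (u : Unique (leaves (node s t))) {i j : Fin n} where

    rl-node-inˡ : i ∈ leaves s → j ∈ leaves s → rl (node s t) i j ≡ rl s i j
    rl-node-inˡ i∈s j∈s with ∈⇒depth≡just s i∈s | ∈⇒depth≡just s j∈s
    ... | _ , eᵢ | _ , eⱼ
      rewrite rl-node s t i j | eᵢ | eⱼ | ∈ˡ⇒depthʳ≡nothing s t u i∈s | ∈ˡ⇒depthʳ≡nothing s t u j∈s = refl

    rl-node-inʳ : i ∈ leaves t → j ∈ leaves t → rl (node s t) i j ≡ rl t i j
    rl-node-inʳ i∈t j∈t with ∈⇒depth≡just t i∈t | ∈⇒depth≡just t j∈t
    ... | _ , eᵢ | _ , eⱼ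
      rewrite rl-node s t i j | eᵢ | eⱼ | ∈ʳ⇒depthˡ≡nothing s t u i∈t | ∈ʳ⇒depthˡ≡nothing s t u j∈t = refl

    lpath-node-inˡ : i ∈ leaves s → j ∈ leaves s → lpath (node s t) i j ≡ rl s i j
    lpath-node-inˡ i∈s j∈s with ∈⇒depth≡just s i∈s | ∈⇒depth≡just s j∈s
    ... | _ , eᵢ | _ , eⱼ
      rewrite lpath-node s t i j | eᵢ | eⱼ | ∈ˡ⇒depthʳ≡nothing s t u i∈s | ∈ˡ⇒depthʳ≡nothing s t u j∈s = refl

  module _ (s t : RT n) {i j : Fin n} (k : Fin n)
           (dˢ : depth s i ≡ depth s j) (dᵗ : depth t i ≡ depth t j)
           (rˢ : rl s i k ≡ rl s j k) (rᵗ : rl t i k ≡ rl t j k) where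

    rl-node-indistinguishable : rl (node s t) i k ≡ rl (node s t) j k
    rl-node-indistinguishable = trans (rl-node s t i k)
      (trans (cong₆ nodeRl dˢ (refl {x = depth t k}) (refl {x = depth s k}) dᵗ rˢ rᵗ) (sym (rl-node s t j k)))

    lpath-node-indistinguishable : lpath (node s t) i k ≡ lpath (node s t) j k
    lpath-node-indistinguishable = trans (lpath-node s t i k)
      (trans (cong₆ nodeLpath dˢ (refl {x = depth t k}) (refl {x = depth s k}) dᵗ rˢ rᵗ) (sym (lpath-node s t j k)))

  data HasCherry : RT n → Fin n → Fin n → Set where
    cherry : ∀ {i j} → HasCherry (node (leaf i) (leaf j)) i j
    left   : ∀ {s t i j} → HasCherry s i j → HasCherry (node s t) i j
    right  : ∀ {s t i j} → HasCherry t i j → HasCherry (node s t) i j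

  hasCherry : (s : RT n) → IsNode s → Σ (Fin n) λ i → Σ (Fin n) λ j → HasCherry s i j
  hasCherry (node (leaf a) (leaf b))   _ = a , b , cherry
  hasCherry (node (node s t) _)        _ = let i , j , c = hasCherry (node s t) tt in i , j , left c
  hasCherry (node (leaf _) (node s t)) _ = let i , j , c = hasCherry (node s t) tt in i , j , right c

  cherry-∈ˡ : ∀ {s i j} → HasCherry s i j → i ∈ leaves s
  cherry-∈ˡ cherry                = here refl
  cherry-∈ˡ (left c)              = ∈-++⁺ˡ (cherry-∈ˡ c)
  cherry-∈ˡ {node s _} (right c)  = ∈-++⁺ʳ (leaves s) (cherry-∈ˡ c)

  cherry-∈ʳ : ∀ {s i j} → HasCherry s i j → j ∈ leaves s
  cherry-∈ʳ cherry                = there (here refl)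
  cherry-∈ʳ (left c)              = ∈-++⁺ˡ (cherry-∈ʳ c)
  cherry-∈ʳ {node s _} (right c)  = ∈-++⁺ʳ (leaves s) (cherry-∈ʳ c)

  cherry-≢ : ∀ {s i j} → Unique (leaves s) → HasCherry s i j → i ≢ j
  cherry-≢ ((i≢j All.∷ _) ∷ _) cherry    = i≢j
  cherry-≢ {node s t} u        (left c)  = cherry-≢ (Unique-nodeˡ s t u) c
  cherry-≢ {node s t} u        (right c) = cherry-≢ (Unique-nodeʳ s t u) c

  cherry-depth : ∀ {s i j} → Unique (leaves s) → HasCherry s i j → depth s i ≡ depth s j
  cherry-depth {node (leaf i) (leaf j)} u cherry
    rewrite depth-node (leaf i) (leaf j) i | depth-node (leaf i) (leaf j) j
          | depth-leaf-self i | depth-leaf-self j | depth-leaf-other (cherry-≢ u cherry) = refl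
  cherry-depth {node s t} {i} {j} u (left c) = begin
    depth (node s t) i          ≡⟨ depth-node s t i ⟩
    nodeDepth (depth s i) (depth t i)
      ≡⟨ cong₂ nodeDepth (cherry-depth (Unique-nodeˡ s t u) c) (∈ˡ⇒depthʳ-≡ s t u (cherry-∈ˡ c) (cherry-∈ʳ c)) ⟩
    nodeDepth (depth s j) (depth t j) ≡⟨ depth-node s t j ⟨
    depth (node s t) j          ∎
    where open ≡-Reasoning
  cherry-depth {node s t} {i} {j} u (right c) = begin
    depth (node s t) i          ≡⟨ depth-node s t i ⟩
    nodeDepth (depth s i) (depth t i)
      ≡⟨ cong₂ nodeDepth (∈ʳ⇒depthˡ-≡ s t u (cherry-∈ˡ c) (cherry-∈ʳ c)) (cherry-depth (Unique-nodeʳ s t u) c) ⟩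
    nodeDepth (depth s j) (depth t j) ≡⟨ depth-node s t j ⟨
    depth (node s t) j          ∎
    where open ≡-Reasoning

  cherry-rl : ∀ {s i j} → Unique (leaves s) → HasCherry s i j → rl s i j ≡ 1
  cherry-rl {node (leaf i) (leaf j)} u cherry
    rewrite rl-node (leaf i) (leaf j) i j | depth-leaf-self i | depth-leaf-self j = refl
  cherry-rl {node s t} u (left c) =
    trans (rl-node-inˡ s t u (cherry-∈ˡ c) (cherry-∈ʳ c)) (cherry-rl (Unique-nodeˡ s t u) c)
  cherry-rl {node s t} u (right c) =
    trans (rl-node-inʳ s t u (cherry-∈ˡ c) (cherry-∈ʳ c)) (cherry-rl (Unique-nodeʳ s t u) c)

  cherry-rl-twins : ∀ {s i j k} → Unique (leaves s) → HasCherry s i j → k ≢ i → k ≢ j → rl s i k ≡ rl s j k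
  cherry-rl-twins {node (leaf i) (leaf j)} {k = k} _ cherry k≢i k≢j = trans (rl-absentʳ s i k∉) (sym (rl-absentʳ s j k∉))
    where
    s = node (leaf i) (leaf j)
    k∉ : depth s k ≡ nothing
    k∉ = ∉⇒depth≡nothing s λ { (here k≡i) → k≢i k≡i ; (there (here k≡j)) → k≢j k≡j }
  cherry-rl-twins {node s t} {k = k} u (left c) k≢i k≢j = rl-node-indistinguishable s t k
    (cherry-depth (Unique-nodeˡ s t u) c) (∈ˡ⇒depthʳ-≡ s t u (cherry-∈ˡ c) (cherry-∈ʳ c))
    (cherry-rl-twins (Unique-nodeˡ s t u) c k≢i k≢j) (∈ˡ⇒rlʳ-≡ s t u (cherry-∈ˡ c) (cherry-∈ʳ c) k)
  cherry-rl-twins {node s t} {k = k} u (right c) k≢i k≢j = rl-node-indistinguishable s t k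
    (∈ʳ⇒depthˡ-≡ s t u (cherry-∈ˡ c) (cherry-∈ʳ c)) (cherry-depth (Unique-nodeʳ s t u) c)
    (∈ʳ⇒rlˡ-≡ s t u (cherry-∈ˡ c) (cherry-∈ʳ c) k) (cherry-rl-twins (Unique-nodeʳ s t u) c k≢i k≢j)

  module _ (s t : RT n) (u : Unique (leaves (node s t))) {i j : Fin n} (c : HasCherry s i j) where

    cherry-lpath : lpath (node s t) i j ≡ 1
    cherry-lpath = trans (lpath-node-inˡ s t u (cherry-∈ˡ c) (cherry-∈ʳ c)) (cherry-rl (Unique-nodeˡ s t u) c)

    cherry-lpath-twins : ∀ {k} → k ≢ i → k ≢ j → lpath (node s t) i k ≡ lpath (node s t) j k
    cherry-lpath-twins {k} k≢i k≢j = lpath-node-indistinguishable s t k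
      (cherry-depth (Unique-nodeˡ s t u) c) (∈ˡ⇒depthʳ-≡ s t u (cherry-∈ˡ c) (cherry-∈ʳ c))
      (cherry-rl-twins (Unique-nodeˡ s t u) c k≢i k≢j) (∈ˡ⇒rlʳ-≡ s t u (cherry-∈ˡ c) (cherry-∈ʳ c) k)

-- Quartet trees

module _ {n : ℕ} where

  open DecMembership (_≟_ {n}) using (_∈?_; _∉?_)

  fresh : (xs : List (Fin n)) → length xs ℕ.< n → ∃ λ z → z ∉ xs
  fresh xs |xs|<n = ¬∀⟶∃¬ n (_∈ xs) (_∈? xs) λ all∈ →
    let a , b , a<b , same = pigeonhole |xs|<n (λ z → index (all∈ z)) in
    <⇒≢ᶠ a<b (trans (lookup-index (all∈ a)) (trans (cong (lookup xs) same) (sym (lookup-index (all∈ b)))))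

  complement : List (Fin n) → List (Fin n)
  complement xs = filter (_∉? xs) (allFin n)

  isTree-++-complement : ∀ {xs} (t : RT n) → leaves t ≡ xs ++ complement xs → Unique xs → IsTree t
  isTree-++-complement {xs} t eq u = subst Unique (sym eq) unique , λ z → subst (z ∈_) (sym eq) (covers z)
    where
    unique : Unique (xs ++ complement xs)
    unique = Unique-++⁺ u (filter⁺ (_∉? xs) (allFin⁺ n))
      λ (z∈xs , z∈c) → proj₂ (∈-filter⁻ (_∉? xs) {xs = allFin n} z∈c) z∈xs
    covers : ∀ z → z ∈ xs ++ complement xs
    covers z with z ∈? xs
    ... | yes z∈xs = ∈-++⁺ˡ z∈xs
    ... | no  z∉xs = ∈-++⁺ʳ xs (∈-filter⁺ (_∉? xs) (∈-allFin z) z∉xs)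

  caterpillar : Fin n → List (Fin n) → RT n
  caterpillar a []       = leaf a
  caterpillar a (b ∷ bs) = node (leaf a) (caterpillar b bs)

  leaves-caterpillar : ∀ a bs → leaves (caterpillar a bs) ≡ a ∷ bs
  leaves-caterpillar a []       = refl
  leaves-caterpillar a (b ∷ bs) = cong (a ∷_) (leaves-caterpillar b bs)

  -- the unrooted tree ((a, b), c, (d, …)), with all remaining labels on a caterpillar after d
  quartet : Fin n → Fin n → Fin n → Fin n → RT n
  quartet a b c d = node (node (leaf a) (leaf b)) (node (leaf c) (caterpillar d (complement (a ∷ b ∷ c ∷ d ∷ []))))

  module _ {a b c d : Fin n} (u : Unique (a ∷ b ∷ c ∷ d ∷ [])) where

    quartet-isTree : IsTree (quartet a b c d)
    quartet-isTree = isTree-++-complement (quartet a b c d)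
      (cong (λ ds → a ∷ b ∷ c ∷ ds) (leaves-caterpillar d _)) u

    quartet-lpath-ab : lpath (quartet a b c d) a b ≡ 1
    quartet-lpath-ab = cherry-lpath _ _ (proj₁ quartet-isTree) cherry

  quartet-lpath-ac : ∀ a b c d → lpath (quartet a b c d) a c ≡ 2
  quartet-lpath-ac a b c d
    rewrite lpath-node (node (leaf a) (leaf b)) (node (leaf c) (caterpillar d (complement (a ∷ b ∷ c ∷ d ∷ [])))) a c
          | depth-node (leaf a) (leaf b) a | depth-node (leaf c) (caterpillar d (complement (a ∷ b ∷ c ∷ d ∷ []))) c
          | depth-leaf-self a | depth-leaf-self c = refl

  quartet-lpath-bc : ∀ {a b c d} → Unique (a ∷ b ∷ c ∷ d ∷ []) → lpath (quartet a b c d) b c ≡ 2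
  quartet-lpath-bc {a} {b} {c} {d} u@((_ All.∷ a≢c All.∷ _) ∷ (b≢c All.∷ _) ∷ _) =
    trans (sym (cherry-lpath-twins _ _ (proj₁ (quartet-isTree u)) cherry (≢-sym a≢c) (≢-sym b≢c)))
          (quartet-lpath-ac a b c d)

-- Affine independence

sumF-cong : ∀ {m} {f g : Fin m → ℚ} → (∀ r → f r ≡ g r) → sumF f ≡ sumF g
sumF-cong {zero}  f≗g = refl
sumF-cong {suc m} f≗g = cong₂ _+ℚ_ (f≗g zero) (sumF-cong (f≗g ∘ suc))

sumF-distribʳ : ∀ {m} (c : Fin m → ℚ) v → sumF (λ r → c r * v) ≡ sumF c * v
sumF-distribʳ {zero}  c v = sym (*-zeroˡ v)
sumF-distribʳ {suc m} c v = trans (cong (c zero * v +ℚ_) (sumF-distribʳ (c ∘ suc) v))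
                                  (sym (*-distribʳ-+ v (c zero) (sumF (c ∘ suc))))

vanishes-off-diagonal : ∀ {m n} (c : Fin m → ℚ) (P : Fin m → Fin n → Fin n → ℚ) →
  (∀ r a b → P r a b ≡ P r b a) → (∀ a b → a < b → sumF (λ r → c r * P r a b) ≡ 0ℚ) →
  ∀ a b → a ≢ b → sumF (λ r → c r * P r a b) ≡ 0ℚ
vanishes-off-diagonal c P P-sym vanish a b a≢b with <-cmp a b
... | tri< a<b _ _ = vanish a b a<b
... | tri≈ _ a≡b _ = ⊥-elim (a≢b a≡b)
... | tri> _ _ b<a = trans (sumF-cong λ r → cong (c r *_) (P-sym r a b)) (vanish b a b<a)

p*q≡0⇒p≡0 : ∀ p q → q ≢ 0ℚ → p * q ≡ 0ℚ → p ≡ 0ℚ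
p*q≡0⇒p≡0 p q q≢0 pq≡0 = begin
  p                ≡⟨ *-identityʳ p ⟨
  p * 1ℚ           ≡⟨ cong (p *_) (*-inverseʳ q) ⟨
  p * (q * 1/ q)   ≡⟨ *-assoc p q (1/ q) ⟨
  (p * q) * 1/ q   ≡⟨ cong (_* 1/ q) pq≡0 ⟩
  0ℚ * 1/ q        ≡⟨ *-zeroˡ (1/ q) ⟩
  0ℚ               ∎
  where open ≡-Reasoning
        instance _ = ≢-nonZero q≢0

p-q≡0⇒p≡q : ∀ p q → p - q ≡ 0ℚ → p ≡ q
p-q≡0⇒p≡q = GroupProperties.x∙y⁻¹≈ε⇒x≈y +-0-group

two-coefficients-vanish : ∀ {U V c₀ c₁ S T} → U ≢ V → c₀ +ℚ (c₁ +ℚ S) ≡ 0ℚ →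
  c₀ * U +ℚ (c₁ * U +ℚ S * V) ≡ 0ℚ → c₀ * V +ℚ (c₁ * U +ℚ T) ≡ 0ℚ → c₀ * U +ℚ (c₁ * V +ℚ T) ≡ 0ℚ →
  c₀ ≡ 0ℚ × c₁ ≡ 0ℚ
two-coefficients-vanish {U} {V} {c₀} {c₁} {S} {T} U≢V total eA eB eC = c₀≡0 , trans (sym c₀≡c₁) c₀≡0
  where
  open +-*-Solver
  c₀-c₁≡0 : c₀ - c₁ ≡ 0ℚ
  c₀-c₁≡0 = p*q≡0⇒p≡0 (c₀ - c₁) (V - U) (U≢V ∘ sym ∘ p-q≡0⇒p≡q V U) (begin
    (c₀ - c₁) * (V - U)                                  ≡⟨ solve 5 (λ c₀ c₁ T U V →
                                                               (c₀ :- c₁) :* (V :- U) := (c₀ :* V :+ (c₁ :* U :+ T)) :- (c₀ :* U :+ (c₁ :* V :+ T)))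
                                                               refl c₀ c₁ T U V ⟩
    (c₀ * V +ℚ (c₁ * U +ℚ T)) - (c₀ * U +ℚ (c₁ * V +ℚ T)) ≡⟨ cong₂ _-_ eB eC ⟩
    0ℚ - 0ℚ                                              ≡⟨⟩
    0ℚ                                                   ∎)
    where open ≡-Reasoning
  c₀≡c₁ : c₀ ≡ c₁
  c₀≡c₁ = p-q≡0⇒p≡q c₀ c₁ c₀-c₁≡0
  c₀+c₁≡0 : c₀ +ℚ c₁ ≡ 0ℚ
  c₀+c₁≡0 = p*q≡0⇒p≡0 (c₀ +ℚ c₁) (U - V) (U≢V ∘ p-q≡0⇒p≡q U V) (begin
    (c₀ +ℚ c₁) * (U - V)                                   ≡⟨ solve 5 (λ c₀ c₁ S U V →
                                                               (c₀ :+ c₁) :* (U :- V) := (c₀ :* U :+ (c₁ :* U :+ S :* V)) :- (c₀ :+ (c₁ :+ S)) :* V)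
                                                               refl c₀ c₁ S U V ⟩
    (c₀ * U +ℚ (c₁ * U +ℚ S * V)) - (c₀ +ℚ (c₁ +ℚ S)) * V ≡⟨ cong₂ (λ e e′ → e - e′ * V) eA total ⟩
    0ℚ - 0ℚ * V                                           ≡⟨ cong (0ℚ -_) (*-zeroˡ V) ⟩
    0ℚ                                                    ∎)
    where open ≡-Reasoning
  c₀≡0 : c₀ ≡ 0ℚ
  c₀≡0 = p*q≡0⇒p≡0 c₀ (1ℚ +ℚ 1ℚ) (λ ()) (begin
    c₀ * (1ℚ +ℚ 1ℚ)           ≡⟨ solve 2 (λ c₀ c₁ → c₀ :* (con 1ℚ :+ con 1ℚ) := (c₀ :- c₁) :+ (c₀ :+ c₁)) refl c₀ c₁ ⟩
    (c₀ - c₁) +ℚ (c₀ +ℚ c₁)   ≡⟨ cong₂ _+ℚ_ c₀-c₁≡0 c₀+c₁≡0 ⟩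
    0ℚ                        ∎)
    where open ≡-Reasoning

private
  zero-heads : ∀ {c₀ c₁} x → c₀ ≡ 0ℚ → c₁ ≡ 0ℚ → c₀ +ℚ (c₁ +ℚ x) ≡ x
  zero-heads x refl refl = trans (+-identityˡ _) (+-identityˡ x)

  zero-heads* : ∀ {c₀ c₁} a b x → c₀ ≡ 0ℚ → c₁ ≡ 0ℚ → c₀ * a +ℚ (c₁ * b +ℚ x) ≡ x
  zero-heads* a b x refl refl =
    trans (cong₂ _+ℚ_ (*-zeroˡ a) (cong (_+ℚ x) (*-zeroˡ b))) (zero-heads x refl refl)

module _ {n d : ℕ} {P : Fin (3 + d) → Fin n → Fin n → ℚ} {i j k : Fin n} {U V : ℚ}
  (P-sym : ∀ r a b → P r a b ≡ P r b a) (U≢V : U ≢ V) (i≢j : i ≢ j) (k≢i : k ≢ i) (k≢j : k ≢ j)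
  (P₀ : P zero i j ≡ U × P zero k i ≡ V × P zero k j ≡ U)
  (P₁ : P (suc zero) i j ≡ U × P (suc zero) k i ≡ U × P (suc zero) k j ≡ V)
  (Pₛ : ∀ r → P (suc (suc r)) i j ≡ V × P (suc (suc r)) k i ≡ P (suc (suc r)) k j) where

  AffIndep-extend₂ : AffIndep (λ r → P (suc (suc r))) → AffIndep P
  AffIndep-extend₂ indep c total vanish = coefficient
    where
    c₀ = c zero
    c₁ = c (suc zero)
    c′ = λ r → c (suc (suc r))
    S = sumF c′
    T = sumF (λ r → c′ r * P (suc (suc r)) k i)

    vanish′ : ∀ a b → a ≢ b → sumF (λ r → c r * P r a b) ≡ 0ℚ
    vanish′ = vanishes-off-diagonal c P P-sym vanish

    eA : c₀ * U +ℚ (c₁ * U +ℚ S * V) ≡ 0ℚ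
    eA = trans (sym (cong₂ _+ℚ_ (cong (c₀ *_) (proj₁ P₀)) (cong₂ _+ℚ_ (cong (c₁ *_) (proj₁ P₁))
           (trans (sumF-cong λ r → cong (c′ r *_) (proj₁ (Pₛ r))) (sumF-distribʳ c′ V)))))
           (vanish′ i j i≢j)

    eB : c₀ * V +ℚ (c₁ * U +ℚ T) ≡ 0ℚ
    eB = trans (sym (cong₂ _+ℚ_ (cong (c₀ *_) (proj₁ (proj₂ P₀))) (cong (_+ℚ T) (cong (c₁ *_) (proj₁ (proj₂ P₁))))))
           (vanish′ k i k≢i)

    eC : c₀ * U +ℚ (c₁ * V +ℚ T) ≡ 0ℚ
    eC = trans (sym (cong₂ _+ℚ_ (cong (c₀ *_) (proj₂ (proj₂ P₀))) (cong₂ _+ℚ_ (cong (c₁ *_) (proj₂ (proj₂ P₁)))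
           (sumF-cong λ r → cong (c′ r *_) (sym (proj₂ (Pₛ r)))))))
           (vanish′ k j (k≢j))

    new-zero : c₀ ≡ 0ℚ × c₁ ≡ 0ℚ
    new-zero = two-coefficients-vanish U≢V total eA eB eC

    coefficient : ∀ r → c r ≡ 0ℚ
    coefficient zero          = proj₁ new-zero
    coefficient (suc zero)    = proj₂ new-zero
    coefficient (suc (suc r)) = indep c′
      (trans (sym (zero-heads S (proj₁ new-zero) (proj₂ new-zero))) total)
      (λ a b a<b → trans (sym (zero-heads* (P zero a b) (P (suc zero) a b) _ (proj₁ new-zero) (proj₂ new-zero))) (vanish a b a<b))
      r

+/1-injective : ∀ {a b} → (+ a) / 1 ≡ (+ b) / 1 → a ≡ b
+/1-injective {a} {b} eq = ℤ.+-injective (cong ↥_ (trans (sym (/1-normal a)) (trans eq (/1-normal b))))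
  where /1-normal = λ c → normalize-coprime (Coprimality.sym (Coprimality.1-coprimeTo c))

module _ {n : ℕ} where

  fresh₂ : ∀ {i j : Fin n} → i ≢ j → 3 ℕ.< n → Σ (Fin n) λ a → Σ (Fin n) λ b → Unique (a ∷ i ∷ j ∷ b ∷ [])
  fresh₂ {i} {j} i≢j 3<n with fresh (i ∷ j ∷ []) (ℕ.<-trans (ℕ.n<1+n 2) 3<n)
  ... | b , b∉ with fresh (i ∷ j ∷ b ∷ []) 3<n
  ...   | a , a∉ = a , b , All.¬Any⇒All¬ _ a∉
                         ∷ (i≢j All.∷ ≢-sym (b∉ ∘ here) All.∷ All.[])
                         ∷ (≢-sym (b∉ ∘ there ∘ here) All.∷ All.[])
                         ∷ (All.[] ∷ [])

  contains-cherry-lpath : ∀ {t : RT n} {C : Clade n} {i j} → Unique (leaves t) → Contains t C →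
    HasCherry (shape C) i j → lpath t i j ≡ 1 × (∀ {k} → k ≢ i → k ≢ j → lpath t k i ≡ lpath t k j)
  contains-cherry-lpath {t} {C} {i} {j} u (D , t~CD) c =
    trans (~-lpath t~CD u i j) (cherry-lpath (shape C) D u′ c) , twins
    where
    u′ = Unique-resp-~ t~CD u
    twins : ∀ {k} → k ≢ i → k ≢ j → lpath t k i ≡ lpath t k j
    twins {k} k≢i k≢j = begin
      lpath t k i                  ≡⟨ lpath-sym t u k i ⟩
      lpath t i k                  ≡⟨ ~-lpath t~CD u i k ⟩
      lpath (node (shape C) D) i k ≡⟨ cherry-lpath-twins (shape C) D u′ c k≢i k≢j ⟩
      lpath (node (shape C) D) j k ≡⟨ ~-lpath t~CD u j k ⟨
      lpath t j k                  ≡⟨ lpath-sym t u j k ⟩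
      lpath t k j                  ∎
      where open ≡-Reasoning

module _ {m k d : ℕ} (C : Fin (suc k) → Clade (4 + m)) {i j a b : Fin (4 + m)}
         (c : HasCherry (shape (C zero)) i j) (u : Unique (a ∷ i ∷ j ∷ b ∷ [])) where

  private
    xₗ : ℕ → ℚ
    xₗ l = (+ (2 ^ (4 + m ∸ 2 ∸ l))) / 1

    xₗ2≢xₗ1 : xₗ 2 ≢ xₗ 1
    xₗ2≢xₗ1 = ℕ.<⇒≢ (^-monoʳ-< 2 (s≤s (s≤s z≤n)) (ℕ.n<1+n m)) ∘ +/1-injective

    u′ : Unique (a ∷ j ∷ i ∷ b ∷ [])
    u′ = Unique-swap u

  cladeFace-indep⇒trees-indep : HasIndep (CladeFace C) d → HasIndep (IsTree {4 + m}) (2 + d)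
  cladeFace-indep⇒trees-indep (ts , ts∈F , indep) = trees , isTree ,
    AffIndep-extend₂ x-sym xₗ2≢xₗ1 (i≢j u) (a≢i u) (a≢j u)
      (cong xₗ (quartet-lpath-bc u) , cong xₗ (quartet-lpath-ab u) , cong xₗ (quartet-lpath-ac a i j b))
      (cong xₗ (trans (lpath-sym (trees (suc zero)) (proj₁ (isTree (suc zero))) i j) (quartet-lpath-bc u′)) ,
       cong xₗ (quartet-lpath-ac a j i b) , cong xₗ (quartet-lpath-ab u′))
      (λ r → let lij , twins = face r in cong xₗ lij , cong xₗ (twins (a≢i u) (a≢j u)))
      indep
    where
    trees : Fin (3 + d) → RT (4 + m)
    trees = quartet a i j b ◂ quartet a j i b ◂ ts

    isTree : ∀ r → IsTree (trees r)
    isTree zero          = quartet-isTree u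
    isTree (suc zero)    = quartet-isTree u′
    isTree (suc (suc r)) = proj₁ (ts∈F r)

    x-sym : ∀ r p q → x (trees r) p q ≡ x (trees r) q p
    x-sym r p q = cong xₗ (lpath-sym (trees r) (proj₁ (isTree r)) p q)

    face : ∀ r → lpath (ts r) i j ≡ 1 × (∀ {k} → k ≢ i → k ≢ j → lpath (ts r) k i ≡ lpath (ts r) k j)
    face r = contains-cherry-lpath {C = C zero} (proj₁ (proj₁ (ts∈F r))) (proj₂ (ts∈F r) zero) c

    i≢j : Unique (a ∷ i ∷ j ∷ b ∷ []) → i ≢ j
    i≢j (_ ∷ (i≢j All.∷ _) ∷ _) = i≢j
    a≢i : Unique (a ∷ i ∷ j ∷ b ∷ []) → a ≢ i
    a≢i ((a≢i All.∷ _) ∷ _) = a≢i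
    a≢j : Unique (a ∷ i ∷ j ∷ b ∷ []) → a ≢ j
    a≢j ((_ All.∷ a≢j All.∷ _) ∷ _) = a≢j

theorem1 : (n : ℕ) → 4 ≤ n → (k : ℕ) → (C : Fin (suc k) → Clade n) →
    PairwiseDisjoint C →
    Σ (RT n) (CladeFace C) →
    ¬ IsFacetOfBME (CladeFace C)
theorem1 (suc (suc (suc (suc m)))) (s≤s (s≤s (s≤s (s≤s z≤n)))) k C _ _ (d , (F-indep , _) , (_ , ¬P-indep)) =
  let i , j , c = hasCherry (shape (C zero)) (internal (C zero))
      a , b , u = fresh₂ (cherry-≢ (distinct (C zero)) c) (s≤s (s≤s (s≤s (s≤s z≤n))))
  in ¬P-indep (cladeFace-indep⇒trees-indep C c u F-indep)
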